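{- Let $G$ be an $r$-cop-win graph ($r\in\{0,1\}$) of finite corner rank $\alpha\ge2$. Then $G$ is cop-win and $\operatorname{capt}(G)\le\alpha-r$.
   Context: All graphs are finite, nonempty and reflexive (every vertex adjacent to itself). For distinct vertices $v,w$ of a graph $H$, $w$ strictly corners $v$ in $H$ if every vertex of $H$ adjacent to $v$ is adjacent to $w$ and some vertex of $H$ adjacent to $w$ is not adjacent to $v$; a strict corner of $H$ is a vertex strictly cornered in $H$ by another vertex. Corner ranking: $G_1=G$, $k=1$. If $G_k$ is a clique, its vertices get rank $k$; stop. Else if $G_k$ has no strict corners, its vertices get rank $\infty$; stop. Else the set $X$ of strict corners of $G_k$ gets rank $k$, $G_{k+1}=G_k-X$ (induced subgraph), increase $k$, repeat. The corner rank of $G$ is the maximum rank. For finite corner rank $\alpha\ge2$: $G$ is $1$-cop-win if some (equivalently every) vertex of rank $\alpha$ is adjacent to all vertices of $G_{\alpha-1}$, otherwise $0$-cop-win. Game of cops and robber: cop places, robber places, then alternate moves with the cop first; a move is staying or moving to an adjacent vertex; the cop wins when both share a vertex. $G$ is cop-win if the cop can force a win; then $\operatorname{capt}(G)$ is the minimum number of cop moves (placement not counted) within which the cop can guarantee a win. -}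

module Defs where

open import Data.Nat using (ℕ; zero; suc; _≤_; _<_; _∸_)
open import Data.Fin using (Fin)
open import Data.Product using (Σ; ∃; _×_; _,_)
open import Data.Sum using (_⊎_)
open import Data.Unit using (⊤)
open import Relation.Nullary using (¬_; Dec)
open import Relation.Binary.PropositionalEquality using (_≡_; _≢_)

record Graph : Set₁ where
  field
    n     : ℕ
    Adj   : Fin (suc n) → Fin (suc n) → Set
    adj?  : ∀ u v → Dec (Adj u v)
    refl  : ∀ v → Adj v v
    sym   : ∀ {u v} → Adj u v → Adj v u

module _ (G : Graph) where
  open Graph G

  Vtx : Set
  Vtx = Fin (suc n)

  -- a vertex subset (induced subgraph) given as a predicate
  VSet : Set₁
  VSet = Vtx → Set

  StrictlyCorners : VSet → Vtx → Vtx → Set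
  StrictlyCorners S w v =
    S v × S w × w ≢ v
    × (∀ u → S u → Adj u v → Adj u w)
    × (∃ λ u → S u × Adj u w × ¬ Adj u v)

  StrictCorner : VSet → Vtx → Set
  StrictCorner S v = ∃ λ w → StrictlyCorners S w v

  IsClique : VSet → Set
  IsClique S = ∀ u v → S u → S v → Adj u v

  -- the sequence G_1, G_2, ... of the corner ranking (paper indexing, k ≥ 1;
  -- index 0 is unused and set equal to G_1):
  -- G_1 = G, G_{k+1} = G_k minus its strict corners.
  Gk : ℕ → VSet
  Gk zero          = λ _ → ⊤
  Gk (suc zero)    = λ _ → ⊤
  Gk (suc (suc k)) = λ v → Gk (suc k) v × ¬ StrictCorner (Gk (suc k)) v

  HasCornerRank : ℕ → Set
  HasCornerRank α =
    1 ≤ α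
    × (∀ k → 1 ≤ k → k < α → ¬ IsClique (Gk k) × (∃ λ v → StrictCorner (Gk k) v))
    × IsClique (Gk α)

  TopDominates : ℕ → Set
  TopDominates α = ∃ λ v → Gk α v × (∀ u → Gk (α ∸ 1) u → Adj v u)

  IsRCopWin : ℕ → ℕ → Set
  IsRCopWin α r = (r ≡ 1 × TopDominates α) ⊎ (r ≡ 0 × ¬ TopDominates α)

  -- CopWinsIn m c r : it is the cop's turn, cop at c, robber at r; the cop
  -- can force capture using at most m further cop moves.
  data CopWinsIn : ℕ → Vtx → Vtx → Set where
    caught : ∀ {m c r} → c ≡ r → CopWinsIn m c r
    move   : ∀ {m c r} (c' : Vtx) → Adj c c' →
             (c' ≡ r ⊎ (∀ r' → Adj r r' → CopWinsIn m c' r')) →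
             CopWinsIn (suc m) c r

  CaptureWithin : ℕ → Set
  CaptureWithin m = ∃ λ c₀ → ∀ r₀ → CopWinsIn m c₀ r₀

  CopWin : Set
  CopWin = ∃ λ m → CaptureWithin m

  -- capt(G) ≤ k  (capt is the minimum m with CaptureWithin m)
  CaptLe : ℕ → Set
  CaptLe k = ∃ λ m → m ≤ k × CaptureWithin m

-- Every stage G_{k+1} of the corner ranking receives a graph homomorphism
-- ρ_k : G → G_{k+1}, with ρ_0 the identity.  Given ρ_k(x) ∈ G_{k+1},
-- repeatedly replace it by a vertex strictly cornering it in G_{k+1} until a
-- non-corner, i.e. a vertex of G_{k+2}, is reached; this terminates because
-- closed neighbourhoods in G_{k+1} grow strictly, and the result ρ_{k+1}(x)
-- dominates ρ_k(x) in G_{k+1}.  Hence x ~ y implies ρ_{k+1}(x) ~ ρ_k(y).  A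
-- cop adjacent to the robber's shadow ρ_m(r) steps onto it and is then
-- adjacent to the new shadow ρ_{m-1}(r') wherever the robber goes, so it
-- captures within m + 1 moves.  If G_α is a clique, a cop starting in G_α is
-- adjacent to every ρ_{α-1}(r); if a vertex of G_α sees all of G_{α-1}, a cop
-- starting there is adjacent to every ρ_{α-2}(r).
module Submission where

open import Defs
open import Data.Nat using (ℕ; _≤_; _∸_; zero; suc; s≤s)
open import Data.Nat.Induction using (<-wellFounded)
open import Data.Nat.Properties using (≤-refl)
open import Data.Fin using (Fin; zero)
open import Data.Fin.Properties using (any?; all?; _≟_)
open import Data.Fin.Subset using (Subset; _∈_; _⊂_; ∣_∣; ∁)
open import Data.Fin.Subset.Properties using (p⊂q⇒∣p∣<∣q∣; p⊂q⇒∁p⊃∁q)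
open import Data.Vec using (tabulate)
open import Data.Vec.Properties using (lookup∘tabulate; lookup⇒[]=; []=⇒lookup)
open import Data.Product using (∃; _×_; _,_; proj₁; proj₂)
open import Data.Sum using (inj₁; inj₂)
open import Data.Unit using (tt)
open import Function using (_∘_)
open import Induction.WellFounded using (WellFounded; Acc; acc; module Subrelation)
import Relation.Binary.Construct.On as On
open import Relation.Nullary using (yes; no; does; ¬_)
open import Relation.Nullary.Decidable using (dec-true; _×-dec_; _→-dec_; ¬?)
open import Relation.Unary using (Pred; Decidable)
open import Relation.Binary.PropositionalEquality using (refl; trans; sym)

module _ {m ℓ} {P : Pred (Fin m) ℓ} where

  toSubset : Decidable P → Subset m
  toSubset P? = tabulate (does ∘ P?)

  ∈-toSubset⁺ : ∀ (P? : Decidable P) {x} → P x → x ∈ toSubset P?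
  ∈-toSubset⁺ P? {x} px =
    lookup⇒[]= x _ (trans (lookup∘tabulate _ x) (dec-true (P? x) px))

  ∈-toSubset⁻ : ∀ (P? : Decidable P) {x} → x ∈ toSubset P? → P x
  ∈-toSubset⁻ P? {x} x∈ with P? x | trans (sym (lookup∘tabulate (does ∘ P?) x)) ([]=⇒lookup x∈)
  ... | yes px | _ = px
  ... | no _   | ()

module _ (G : Graph) where
  open Graph G using (n; Adj; adj?) renaming (sym to adj-sym)

  Dominates : VSet G → Vtx G → Vtx G → Set
  Dominates S w v = ∀ u → S u → Adj u v → Adj u w

  strictCorner? : ∀ {S} → Decidable S → Decidable (StrictCorner G S)
  strictCorner? S? v = any? λ w → S? v ×-dec S? w ×-dec ¬? (w ≟ v)
    ×-dec all? (λ u → S? u →-dec (adj? u v →-dec adj? u w))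
    ×-dec any? (λ u → S? u ×-dec adj? u w ×-dec ¬? (adj? u v))

  module _ {S : VSet G} (S? : Decidable S) where

    inClosedNbhd? : ∀ v → Decidable (λ u → S u × Adj u v)
    inClosedNbhd? v u = S? u ×-dec adj? u v

    closedNbhd : Vtx G → Subset (suc n)
    closedNbhd = toSubset ∘ inClosedNbhd?

    strictlyCorners⇒closedNbhd⊂ : ∀ {w v} → StrictlyCorners G S w v →
      closedNbhd v ⊂ closedNbhd w
    strictlyCorners⇒closedNbhd⊂ {w} {v} (_ , _ , _ , dom , u , Su , u~w , u≁v) =
      (λ u′∈ → let (Su′ , u′~v) = ∈-toSubset⁻ (inClosedNbhd? v) u′∈ in
               ∈-toSubset⁺ (inClosedNbhd? w) (Su′ , dom _ Su′ u′~v)) ,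
      u , ∈-toSubset⁺ (inClosedNbhd? w) (Su , u~w) ,
      u≁v ∘ proj₂ ∘ ∈-toSubset⁻ (inClosedNbhd? v)

    -- Measured by the number of non-neighbours, which strictly decreases.
    strictlyCorners-wellFounded : WellFounded (StrictlyCorners G S)
    strictlyCorners-wellFounded =
      Subrelation.wellFounded
        (p⊂q⇒∣p∣<∣q∣ ∘ p⊂q⇒∁p⊃∁q ∘ strictlyCorners⇒closedNbhd⊂)
        (On.wellFounded (∣_∣ ∘ ∁ ∘ closedNbhd) <-wellFounded)

    dominatedByNonCorner : ∀ {v} → S v →
      ∃ λ w → (S w × ¬ StrictCorner G S w) × Dominates S w v
    dominatedByNonCorner = climb (strictlyCorners-wellFounded _)
      where
      climb : ∀ {v} → Acc (StrictlyCorners G S) v → S v →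
        ∃ λ w → (S w × ¬ StrictCorner G S w) × Dominates S w v
      climb {v} (acc rs) Sv with strictCorner? S? v
      ... | no v-noCorner = v , (Sv , v-noCorner) , λ _ _ u~v → u~v
      ... | yes (w , w-corners-v@(_ , Sw , _ , dom , _)) with climb (rs w-corners-v) Sw
      ... | x , x-noCorner , x-dom-w = x , x-noCorner , λ u Su → x-dom-w u Su ∘ dom u Su

  Gk? : ∀ k → Decidable (Gk G k)
  Gk? zero          v = yes tt
  Gk? (suc zero)    v = yes tt
  Gk? (suc (suc k)) v = Gk? (suc k) v ×-dec ¬? (strictCorner? (Gk? (suc k)) v)

  ρ : ℕ → Vtx G → Vtx G
  ρ-∈ : ∀ k x → Gk G (suc k) (ρ k x)
  ρ zero    x = x
  ρ (suc k) x = proj₁ (dominatedByNonCorner (Gk? (suc k)) (ρ-∈ k x))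
  ρ-∈ zero    x = tt
  ρ-∈ (suc k) x = proj₁ (proj₂ (dominatedByNonCorner (Gk? (suc k)) (ρ-∈ k x)))

  ρ-suc-dominates : ∀ k x → Dominates (Gk G (suc k)) (ρ (suc k) x) (ρ k x)
  ρ-suc-dominates k x = proj₂ (proj₂ (dominatedByNonCorner (Gk? (suc k)) (ρ-∈ k x)))

  ρ-hom : ∀ k {x y} → Adj x y → Adj (ρ k x) (ρ k y)
  ρ-suc-adj : ∀ k {x y} → Adj x y → Adj (ρ (suc k) x) (ρ k y)
  ρ-suc-adj k {x} {y} x~y =
    adj-sym (ρ-suc-dominates k x (ρ k y) (ρ-∈ k y) (adj-sym (ρ-hom k x~y)))
  ρ-hom zero    x~y = x~y
  ρ-hom (suc k) {x} {y} x~y =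
    ρ-suc-dominates k y (ρ (suc k) x) (proj₁ (ρ-∈ (suc k) x)) (ρ-suc-adj k x~y)

  copWinsIn-chasingShadow : ∀ m {c r} → Adj c (ρ m r) → CopWinsIn G (suc m) c r
  copWinsIn-chasingShadow zero    c~r  = move _ c~r (inj₁ refl)
  copWinsIn-chasingShadow (suc m) c~ρr =
    move _ c~ρr (inj₂ λ _ r~r′ → copWinsIn-chasingShadow m (ρ-suc-adj m r~r′))

  captureWithin-chasingShadow : ∀ m c → (∀ r → Adj c (ρ m r)) → CaptureWithin G (suc m)
  captureWithin-chasingShadow m c c~ρ = c , λ r → copWinsIn-chasingShadow m (c~ρ r)

  copWin×captLe : ∀ {k} → CaptureWithin G k → CopWin G × CaptLe G k
  copWin×captLe {k} w = (k , w) , (k , ≤-refl , w)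

corollary4p13 : (G : Graph) (α r : ℕ) → HasCornerRank G α → 2 ≤ α →
    IsRCopWin G α r → CopWin G × CaptLe G (α ∸ r)
corollary4p13 G (suc (suc m)) _ (_ , _ , Gα-clique) (s≤s (s≤s _)) (inj₂ (refl , _)) =
  copWin×captLe G (captureWithin-chasingShadow G (suc m) c
    λ r → Gα-clique c (ρ G (suc m) r) (ρ-∈ G (suc m) zero) (ρ-∈ G (suc m) r))
  where
  c : Vtx G
  c = ρ G (suc m) zero
corollary4p13 G (suc (suc m)) _ _ (s≤s (s≤s _)) (inj₁ (refl , v , _ , v~Gα₋₁)) =
  copWin×captLe G (captureWithin-chasingShadow G m v λ r → v~Gα₋₁ (ρ G m r) (ρ-∈ G m r))
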